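{- If $G$ is a finite graph of order $n\ge 6$ such that both $G$ and its complement $\overline{G}$ are connected, then $b(G)+b(\overline{G})\le 3\lceil n^{1/2}\rceil-1$ and $b(G)\,b(\overline{G})\le n+6$.
   Context: Burning process on a finite graph: in round 1 one node is chosen and burned; in each round $t\ge 2$, every unburned neighbour of a node burned by the end of round $t-1$ becomes burned, and one additional unburned node (if available) is chosen and burned; burned nodes stay burned. The burning number $b(\cdot)$ is the minimum number of rounds needed until all nodes are burned. -}

module Defs where

open import Data.Nat using (ℕ; zero; suc; _+_; _*_; _≤_; _<_)
open import Data.Fin using (Fin)
open import Data.Product using (Σ; ∃; _×_; _,_)
open import Data.Sum using (_⊎_)
open import Relation.Nullary using (¬_)
open import Relation.Binary.PropositionalEquality using (_≡_; _≢_)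

record Graph (n : ℕ) : Set₁ where
  field
    Adj    : Fin n → Fin n → Set
    sym    : ∀ {u v} → Adj u v → Adj v u
    irrefl : ∀ {u} → ¬ Adj u u
open Graph public

complement : ∀ {n} → Graph n → Graph n
complement G = record
  { Adj    = λ u v → (u ≢ v) × ¬ Adj G u v
  ; sym    = λ { (u≢v , ¬a) → (λ e → u≢v (symm e)) , (λ a → ¬a (Graph.sym G a)) }
  ; irrefl = λ { (u≢u , _) → u≢u _≡_.refl }
  }
  where
  symm : ∀ {A : Set} {x y : A} → x ≡ y → y ≡ x
  symm _≡_.refl = _≡_.refl

data Reach {n} (G : Graph n) : Fin n → Fin n → Set where
  here  : ∀ {u} → Reach G u u
  there : ∀ {u v w} → Adj G u v → Reach G v w → Reach G u w

Connected : ∀ {n} → Graph n → Set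
Connected G = ∀ u v → Reach G u v

-- Burning process driven by a source sequence s : ℕ → Fin n,
-- where s t is the node chosen in round t+1 (rounds are 1-based, indices 0-based).
-- Burned G s t v : v is burned by the end of round t+1.
Burned : ∀ {n} → Graph n → (ℕ → Fin n) → ℕ → Fin n → Set
-- Spread G s t v : v is burned at the end of round t+1 or is a neighbour of such a node
-- (i.e. v is burned in round t+2 by spreading).
Spread : ∀ {n} → Graph n → (ℕ → Fin n) → ℕ → Fin n → Set

Burned G s zero    v = s zero ≡ v
Burned G s (suc t) v = Spread G s t v ⊎ s (suc t) ≡ v

Spread G s t v = Burned G s t v ⊎ ∃ λ u → Burned G s t u × Adj G u v

-- Legal choice in rounds 2..k: the chosen node is unburned (after spreading),
-- unless no unburned node is available.
LegalUpTo : ∀ {n} → Graph n → (ℕ → Fin n) → ℕ → Set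
LegalUpTo G s k = ∀ t → suc t < k →
  ¬ Spread G s t (s (suc t)) ⊎ (∀ v → Spread G s t v)

BurnsIn : ∀ {n} → Graph n → ℕ → Set
BurnsIn G zero    = Data.Empty.⊥
  where import Data.Empty
BurnsIn G (suc m) = ∃ λ (s : ℕ → Fin _) → LegalUpTo G s (suc m) × (∀ v → Burned G s m v)

IsBurningNumber : ∀ {n} → Graph n → ℕ → Set
IsBurningNumber G b = BurnsIn G b × (∀ k → BurnsIn G k → b ≤ k)

IsCeilSqrt : ℕ → ℕ → Set
IsCeilSqrt n c = n ≤ c * c × (∀ d → n ≤ d * d → c ≤ d)

module Submission where

-- 1. Burning from centres: if every vertex lies within distance k of some
--    f j with j + k ≤ m, then the schedule f 0, f 1, … can be repaired into
--    a legal burning sequence that burns the whole graph within m + 1 rounds.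
-- 2. Layers: fix a root r and let depth v be its distance from r.  For
--    q = q' + 1, a level L and a residue i < q, burning r and then all
--    vertices of depth ≥ L and depth ≡ i (mod q) burns G within
--    max(L + q', 1 + #class + q') rounds.  Averaging over the q residues
--    gives a class with q·#class ≤ #{v | depth v ≥ L}.
--    With q = ⌈√n⌉, L = 0 this yields b(G) ≤ 2⌈√n⌉; with q = 3, L = 2 and a
--    root having two distinct neighbours it yields 3·b(G) ≤ n + 6.
-- 3. Fix a vertex r.  Either r reaches every vertex of G within two steps,
--    or some w is at distance ≥ 3 from r, and then r reaches every vertex of
--    the complement within two steps.  Hence b(G) ≤ 3 or b(Ḡ) ≤ 3.
-- 4. Elementary arithmetic combines 3·b ≤ n + 6, b ≤ 2c and b' ≤ 3.
-- The arguments use decidable adjacency; since the conclusion is a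
-- decidable inequality, this is obtained under double negation.

open import Defs hiding (sym)
open import Data.Nat using (ℕ; zero; suc; _+_; _*_; _∸_; _≤_; _<_; _≤′_; ≤′-refl; ≤′-step; z≤n; s≤s; _≤?_; _≤ᵇ_; _≡ᵇ_; _%_; _/_)
open import Data.Nat.Properties
open import Data.Nat.DivMod using (m≡m%n+[m/n]*n; [m+kn]%n≡m%n; m%n<n; m<n⇒m%n≡m)
open import Data.Fin using (Fin; toℕ) renaming (zero to fz; suc to fs)
open import Data.Fin.Properties using (toℕ<n) renaming (_≟_ to _≟ᶠ_; any? to anyᶠ?)
open import Data.Product using (∃; ∃₂; _×_; _,_; proj₁; proj₂)
open import Data.Sum using (_⊎_; inj₁; inj₂)
open import Data.Empty using (⊥-elim)
open import Data.Bool using (Bool; true; false; _∧_; not; T; T?)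
open import Data.Bool.Properties using (T-∧; ∧-identityʳ)
open import Data.List using (List; []; _∷_; length; filterᵇ; allFin; tabulate)
open import Data.List.Membership.Propositional using (_∈_)
open import Data.List.Membership.Propositional.Properties using (∈-filter⁺; ∈-allFin)
open import Data.List.Relation.Unary.Any using (here; there)
open import Data.List.Relation.Unary.All using (All; []; _∷_)
import Data.List.Relation.Unary.All as All
open import Data.List.Relation.Unary.Unique.Propositional using (Unique; []; _∷_)
open import Algebra.Properties.CommutativeMonoid.Sum +-0-commutativeMonoid using (sum; ∑-comm; sum-cong-≗; sum-replicate-zero)
open import Function.Bundles using (Equivalence)
open import Relation.Nullary using (¬_; Dec; yes; no; does)
open import Relation.Nullary.Decidable using (_×-dec_; _⊎-dec_; ¬?; decidable-stable; dec-false; ¬¬-excluded-middle)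
open import Relation.Binary.PropositionalEquality using (_≡_; _≢_; refl; sym; trans; cong; subst; module ≡-Reasoning)

DecidableAdjacency : ∀ {n} → Graph n → Set
DecidableAdjacency {n} G = ∀ (u v : Fin n) → Dec (Adj G u v)

¬¬-∀Fin : ∀ m {P : Fin m → Set} → (∀ x → ¬ ¬ P x) → ¬ ¬ (∀ x → P x)
¬¬-∀Fin zero    h k = k (λ ())
¬¬-∀Fin (suc m) h k =
  h fz (λ p₀ → ¬¬-∀Fin m (λ x → h (fs x)) (λ ps → k (λ { fz → p₀ ; (fs x) → ps x })))

-- Classically every graph has decidable adjacency; constructively this holds
-- under double negation, which suffices for a decidable conclusion.
¬¬-decidableAdjacency : ∀ {n} (G : Graph n) → ¬ ¬ DecidableAdjacency G
¬¬-decidableAdjacency {n} G = ¬¬-∀Fin n (λ u → ¬¬-∀Fin n (λ v → ¬¬-excluded-middle))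

complement-dec : ∀ {n} (G : Graph n) → DecidableAdjacency G → DecidableAdjacency (complement G)
complement-dec G dec u v = ¬? (u ≟ᶠ v) ×-dec ¬? (dec u v)

data Within {n} (G : Graph n) : ℕ → Fin n → Fin n → Set where
  stay : ∀ {k x} → Within G k x x
  step : ∀ {k x w v} → Within G k x w → Adj G w v → Within G (suc k) x v

module Burning {n : ℕ} (G : Graph n) (dec : DecidableAdjacency G) where

  burned? : ∀ s t v → Dec (Burned G s t v)
  spread? : ∀ s t v → Dec (Spread G s t v)
  burned? s zero    v = s zero ≟ᶠ v
  burned? s (suc t) v = spread? s t v ⊎-dec (s (suc t) ≟ᶠ v)
  spread? s t v = burned? s t v ⊎-dec anyᶠ? (λ u → burned? s t u ×-dec dec u v)

  _≈[_]_ : (ℕ → Fin n) → ℕ → (ℕ → Fin n) → Set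
  s ≈[ t ] s' = ∀ {i} → i ≤ t → s i ≡ s' i

  burned-prefix : ∀ {s s'} t → s ≈[ t ] s' → ∀ {v} → Burned G s t v → Burned G s' t v
  spread-prefix : ∀ {s s'} t → s ≈[ t ] s' → ∀ {v} → Spread G s t v → Spread G s' t v
  burned-prefix zero    s≈s' b        = trans (sym (s≈s' z≤n)) b
  burned-prefix (suc t) s≈s' (inj₁ b) = inj₁ (spread-prefix t (λ i≤t → s≈s' (m≤n⇒m≤1+n i≤t)) b)
  burned-prefix (suc t) s≈s' (inj₂ e) = inj₂ (trans (sym (s≈s' ≤-refl)) e)
  spread-prefix t s≈s' (inj₁ b)           = inj₁ (burned-prefix t s≈s' b)
  spread-prefix t s≈s' (inj₂ (u , b , a)) = inj₂ (u , burned-prefix t s≈s' b , a)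

  burned-mono : ∀ {s t t' v} → t ≤′ t' → Burned G s t v → Burned G s t' v
  burned-mono ≤′-refl        b = b
  burned-mono (≤′-step t≤t') b = inj₁ (inj₁ (burned-mono t≤t' b))

  -- The repaired schedule: follow the centres f, but whenever f (t + 1) is
  -- already burning, pick an unburned vertex instead (if any is left).
  module Repair (f : ℕ → Fin n) where

    choice : (ℕ → Fin n) → ℕ → Fin n
    choice h t with spread? h t (f (suc t))
    ... | no _ = f (suc t)
    ... | yes _ with anyᶠ? (λ v → ¬? (spread? h t v))
    ...   | yes (v , _) = v
    ...   | no _        = f (suc t)

    choice-covers : ∀ h t → Spread G h t (f (suc t)) ⊎ choice h t ≡ f (suc t)
    choice-covers h t with spread? h t (f (suc t))
    ... | no _   = inj₂ refl
    ... | yes sp = inj₁ sp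

    choice-legal : ∀ h t → ¬ Spread G h t (choice h t) ⊎ (∀ v → Spread G h t v)
    choice-legal h t with spread? h t (f (suc t))
    ... | no ¬sp = inj₁ ¬sp
    ... | yes _ with anyᶠ? (λ v → ¬? (spread? h t v))
    ...   | yes (_ , ¬sp) = inj₁ ¬sp
    ...   | no none       = inj₂ (λ v → decidable-stable (spread? h t v) (λ ¬sp → none (v , ¬sp)))

    -- history t is a full sequence whose first t + 1 entries are final.
    history : ℕ → ℕ → Fin n
    history zero    = f
    history (suc t) i with i ≤? t
    ... | yes _ = history t i
    ... | no _  = choice (history t) t

    repaired : ℕ → Fin n
    repaired i = history i i

    repaired-suc : ∀ t → repaired (suc t) ≡ choice (history t) t
    repaired-suc t with suc t ≤? t
    ... | yes 1+t≤t = ⊥-elim (<-irrefl refl 1+t≤t)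
    ... | no _      = refl

    history-stable : ∀ t → history t ≈[ t ] repaired
    history-stable zero    z≤n = refl
    history-stable (suc t) {i} i≤1+t with i ≤? t
    ... | yes i≤t = history-stable t i≤t
    ... | no  i≰t rewrite ≤-antisym i≤1+t (≰⇒> i≰t) = sym (repaired-suc t)

    centre-burned : ∀ j → Burned G repaired j (f j)
    centre-burned zero    = refl
    centre-burned (suc t) with choice-covers (history t) t
    ... | inj₁ sp = inj₁ (spread-prefix t (history-stable t) sp)
    ... | inj₂ e  = inj₂ (trans (repaired-suc t) e)

    repaired-legal : ∀ k → LegalUpTo G repaired k
    repaired-legal k t _ with choice-legal (history t) t
    ... | inj₁ ¬sp = inj₁ (λ sp → ¬sp (spread-prefix t (λ i≤t → sym (history-stable t i≤t))
                                        (subst (Spread G repaired t) (repaired-suc t) sp)))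
    ... | inj₂ all = inj₂ (λ v → spread-prefix t (history-stable t) (all v))

    within-burned : ∀ {j k v} → Within G k (f j) v → Burned G repaired (j + k) v
    within-burned {j} {k} stay = burned-mono (≤⇒≤′ (m≤m+n j k)) (centre-burned j)
    within-burned {j} (step {k = k} {w = w} p a) rewrite +-suc j k =
      inj₁ (inj₂ (w , within-burned p , a))

  burnsByCover : (f : ℕ → Fin n) (m : ℕ) →
                 (∀ v → ∃₂ λ j k → j + k ≤ m × Within G k (f j) v) → BurnsIn G (suc m)
  burnsByCover f m cover = repaired , repaired-legal (suc m) , burnsAll
    where
    open Repair f
    burnsAll : ∀ v → Burned G repaired m v
    burnsAll v with cover v
    ... | j , k , j+k≤m , p = burned-mono (≤⇒≤′ j+k≤m) (within-burned p)

radiusTwoBurns : ∀ {n} (G : Graph n) → DecidableAdjacency G →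
                 ∀ u → (∀ w → Within G 2 u w) → BurnsIn G 3
radiusTwoBurns G dec u near = Burning.burnsByCover G dec (λ _ → u) 2 (λ w → 0 , 2 , ≤-refl , near w)

leastWitness : ∀ {P : ℕ → Set} → (∀ k → Dec (P k)) → ∀ {t} → P t →
               ∃ λ k → P k × (∀ {j} → j < k → ¬ P j)
leastWitness P? pt with P? 0
... | yes p₀ = 0 , p₀ , λ ()
leastWitness P? {zero}  pt | no ¬p₀ = ⊥-elim (¬p₀ pt)
leastWitness P? {suc t} pt | no ¬p₀ with leastWitness (λ k → P? (suc k)) pt
... | k , pk , least = suc k , pk , λ { {zero} _ → ¬p₀ ; {suc j} j<k → least (≤-pred j<k) }

module Depth {n : ℕ} (G : Graph n) (dec : DecidableAdjacency G) (conn : Connected G) (r : Fin n) where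

  Ball : ℕ → Fin n → Set
  Ball zero    v = r ≡ v
  Ball (suc t) v = Ball t v ⊎ ∃ λ u → Ball t u × Adj G u v

  ball? : ∀ t v → Dec (Ball t v)
  ball? zero    v = r ≟ᶠ v
  ball? (suc t) v = ball? t v ⊎-dec anyᶠ? (λ u → ball? t u ×-dec dec u v)

  reach-ball : ∀ {x v} t → Reach G x v → Ball t x → ∃ λ t' → Ball t' v
  reach-ball t here        b = t , b
  reach-ball t (there a p) b = reach-ball (suc t) p (inj₂ (_ , b , a))

  depthWitness : ∀ v → ∃ λ k → Ball k v × (∀ {j} → j < k → ¬ Ball j v)
  depthWitness v = leastWitness (λ k → ball? k v) (proj₂ (reach-ball 0 (conn r v) refl))

  depth : Fin n → ℕ
  depth v = proj₁ (depthWitness v)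

  depth-ball : ∀ v → Ball (depth v) v
  depth-ball v = proj₁ (proj₂ (depthWitness v))

  depth-least : ∀ {t v} → Ball t v → depth v ≤ t
  depth-least {t} {v} b = ≮⇒≥ (λ t<d → proj₂ (proj₂ (depthWitness v)) t<d b)

  depth-zero : ∀ {v} → depth v ≡ 0 → r ≡ v
  depth-zero {v} e = subst (λ k → Ball k v) e (depth-ball v)

  depth-neighbour : ∀ {v} → Adj G r v → depth v ≤ 1
  depth-neighbour a = depth-least (inj₂ (r , refl , a))

  parent : ∀ {v m} → depth v ≡ suc m → ∃ λ w → depth w ≡ m × Adj G w v
  parent {v} {m} e with subst (λ k → Ball k v) e (depth-ball v)
  ... | inj₁ b           = ⊥-elim (1+n≰n (subst (_≤ m) e (depth-least b)))
  ... | inj₂ (w , b , a) = w , ≤-antisym (depth-least b) m≤dw , a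
    where
    m≤dw : m ≤ depth w
    m≤dw = ≤-pred (subst (_≤ suc (depth w)) e (depth-least {suc (depth w)} (inj₂ (w , depth-ball w , a))))

  ancestor : ∀ k a v → a + k ≡ depth v → ∃ λ u → depth u ≡ a × Within G k u v
  ancestor zero    a v e = v , trans (sym e) (+-identityʳ a) , stay
  ancestor (suc k) a v e with parent {v} {a + k} (trans (sym e) (+-suc a k))
  ... | w , dw , adj with ancestor k a w (sym dw)
  ... | u , du , p = u , du , step p adj

  root-within : ∀ v → Within G (depth v) r v
  root-within v with ancestor (depth v) 0 v refl
  ... | u , du , p = subst (λ x → Within G (depth v) x v) (sym (depth-zero du)) p

  -- Two neighbours of the middle vertex of a shortest path to a vertex of depth 2.
  depthTwo⇒twoNeighbours : ∀ {v} → depth v ≡ 2 → ∃ λ p → ∃₂ λ a b → Adj G p a × Adj G p b × a ≢ b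
  depthTwo⇒twoNeighbours {v} dv with parent dv
  ... | p , dp , p~v with parent dp
  ...   | w , dw , w~p = p , w , v , Graph.sym G w~p , p~v , λ { refl → 0≢1+n (trans (sym dw) dv) }

  -- Without vertices of depth 2 there are none deeper either: each has an ancestor at depth 2.
  noDepthTwo⇒shallow : (∀ v → depth v ≢ 2) → ∀ v → depth v ≤ 1
  noDepthTwo⇒shallow none v with depth v ≤? 1
  ... | yes d≤1 = d≤1
  ... | no  d≰1 with ancestor (depth v ∸ 2) 2 v (m+[n∸m]≡n (≰⇒> d≰1))
  ...   | u , du , _ = ⊥-elim (none u du)

  noDepthTwo⇒rootAdjacent : (∀ v → depth v ≢ 2) → ∀ v → r ≢ v → Adj G r v
  noDepthTwo⇒rootAdjacent none v r≢v with depth v in e | noDepthTwo⇒shallow none v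
  ... | zero        | _ = ⊥-elim (r≢v (depth-zero e))
  ... | suc (suc _) | s≤s ()
  ... | suc zero    | _ with parent e
  ...   | w , dw , a = subst (λ x → Adj G x v) (sym (depth-zero dw)) a

module _ {k} (G : Graph (3 + k)) (dec : DecidableAdjacency G) (conn : Connected G) where
  open Depth G dec conn fz

  twoNeighbours : ∃ λ r → ∃₂ λ a b → Adj G r a × Adj G r b × a ≢ b
  twoNeighbours with anyᶠ? (λ v → depth v ≟ 2)
  ... | yes (v , dv) = depthTwo⇒twoNeighbours {v} dv
  ... | no none      = fz , fs fz , fs (fs fz) , rootAdjacent (fs fz) (λ ()) , rootAdjacent (fs (fs fz)) (λ ()) , λ ()
    where
    rootAdjacent : ∀ v → fz ≢ v → Adj G fz v
    rootAdjacent = noDepthTwo⇒rootAdjacent (λ v dv → none (v , dv))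

𝟙 : Bool → ℕ
𝟙 true  = 1
𝟙 false = 0

count : ∀ {n} → (Fin n → Bool) → ℕ
count {n} p = sum (λ v → 𝟙 (p v))

count≤n : ∀ {n} (p : Fin n → Bool) → count p ≤ n
count≤n {zero}  p = z≤n
count≤n {suc n} p with p fz
... | true  = s≤s (count≤n (λ v → p (fs v)))
... | false = m≤n⇒m≤1+n (count≤n (λ v → p (fs v)))

count-complement : ∀ {n} (p : Fin n → Bool) → count p + count (λ v → not (p v)) ≡ n
count-complement {zero}  p = refl
count-complement {suc n} p with p fz
... | true  = cong suc (count-complement (λ v → p (fs v)))
... | false = trans (+-suc (count (λ v → p (fs v))) _) (cong suc (count-complement (λ v → p (fs v))))

length-filter-tabulate : ∀ {A : Set} {n} (g : Fin n → A) (p : A → Bool) →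
                         length (filterᵇ p (tabulate g)) ≡ count (λ v → p (g v))
length-filter-tabulate {n = zero}  g p = refl
length-filter-tabulate {n = suc n} g p with p (g fz)
... | true  = cong suc (length-filter-tabulate (λ v → g (fs v)) p)
... | false = length-filter-tabulate (λ v → g (fs v)) p

count-remove : ∀ {n} (p : Fin n → Bool) x → T (p x) →
               count p ≡ suc (count (λ v → p v ∧ not (does (v ≟ᶠ x))))
count-remove {suc n} p fz px with p fz
... | true  = cong suc (sum-cong-≗ (λ v → cong 𝟙 (sym (∧-identityʳ (p (fs v))))))
count-remove {suc n} p (fs x) px = begin
  𝟙 (p fz) + count (λ v → p (fs v))  ≡⟨ cong (𝟙 (p fz) +_) (count-remove (λ v → p (fs v)) x px) ⟩
  𝟙 (p fz) + suc rest                ≡⟨ +-suc (𝟙 (p fz)) rest ⟩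
  suc (𝟙 (p fz) + rest)              ≡⟨ cong (λ b → suc (𝟙 b + rest)) (∧-identityʳ (p fz)) ⟨
  suc (𝟙 (p fz ∧ true) + rest)       ∎
  where
  open ≡-Reasoning
  rest : ℕ
  rest = count (λ v → p (fs v) ∧ not (does (v ≟ᶠ x)))

distinct≤count : ∀ {n} (p : Fin n → Bool) {xs : List (Fin n)} →
                 Unique xs → All (λ v → T (p v)) xs → length xs ≤ count p
distinct≤count p []                      []         = z≤n
distinct≤count p {x ∷ xs} (x∉xs ∷ uniq) (px ∷ pxs) =
  subst (suc (length xs) ≤_) (sym (count-remove p x px))
    (s≤s (distinct≤count _ uniq (All.zipWith keep (x∉xs , pxs))))
  where
  keep : ∀ {v} → x ≢ v × T (p v) → T (p v ∧ not (does (v ≟ᶠ x)))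
  keep {v} (x≢v , pv) = Equivalence.from T-∧
    (pv , subst (λ b → T (not b)) (sym (dec-false (v ≟ᶠ x) (λ e → x≢v (sym e)))) _)

∑-indicator : ∀ q x → x < q → sum {q} (λ i → 𝟙 (x ≡ᵇ toℕ i)) ≡ 1
∑-indicator (suc q) zero    _         = cong suc (sum-replicate-zero q)
∑-indicator (suc q) (suc x) (s≤s x<q) = ∑-indicator q x x<q

count-partition : ∀ {n} q (p : Fin n → Bool) (key : Fin n → ℕ) → (∀ v → key v < q) →
                  sum {q} (λ i → count (λ v → p v ∧ (key v ≡ᵇ toℕ i))) ≡ count p
count-partition {n} q p key key<q = trans (∑-comm {q} {n} (λ i v → 𝟙 (p v ∧ (key v ≡ᵇ toℕ i)))) (sum-cong-≗ split)
  where
  split : ∀ v → sum {q} (λ i → 𝟙 (p v ∧ (key v ≡ᵇ toℕ i))) ≡ 𝟙 (p v)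
  split v with p v
  ... | true  = ∑-indicator q (key v) (key<q v)
  ... | false = sum-replicate-zero q

belowAverage : ∀ q' (g : Fin (suc q') → ℕ) → ∃ λ i → suc q' * g i ≤ sum g
belowAverage zero     g = fz , ≤-refl
belowAverage (suc q') g with belowAverage q' (λ i → g (fs i))
... | i , avg with g fz ≤? g (fs i)
... | yes g₀≤gᵢ = fz , +-monoʳ-≤ (g fz) (≤-trans (*-monoʳ-≤ (suc q') g₀≤gᵢ) avg)
... | no  g₀≰gᵢ = fs i , +-mono-≤ (<⇒≤ (≰⇒> g₀≰gᵢ)) avg

residueBelow : ∀ q' i D → i < suc q' → i ≤ D →
               ∃₂ λ a k → a + k ≡ D × k ≤ q' × a % suc q' ≡ i
residueBelow q' i D i<q i≤D =
  i + x / q * q , x % q , decompose , ≤-pred (m%n<n x q) , residue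
  where
  q = suc q'
  x = D ∸ i
  decompose : i + x / q * q + x % q ≡ D
  decompose = begin
    i + x / q * q + x % q   ≡⟨ +-assoc i _ _ ⟩
    i + (x / q * q + x % q) ≡⟨ cong (i +_) (+-comm (x / q * q) (x % q)) ⟩
    i + (x % q + x / q * q) ≡⟨ cong (i +_) (sym (m≡m%n+[m/n]*n x q)) ⟩
    i + x                   ≡⟨ m+[n∸m]≡n i≤D ⟩
    D ∎
    where open ≡-Reasoning
  residue : (i + x / q * q) % q ≡ i
  residue = trans ([m+kn]%n≡m%n i (x / q) q) (m<n⇒m%n≡m i<q)

nth : ∀ {A : Set} → List A → ℕ → A → A
nth []       j       d = d
nth (x ∷ xs) zero    d = x
nth (x ∷ xs) (suc j) d = nth xs j d

∈⇒nth : ∀ {A : Set} {x : A} {xs : List A} d → x ∈ xs → ∃ λ j → j < length xs × nth xs j d ≡ x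
∈⇒nth d (here refl) = 0 , s≤s z≤n , refl
∈⇒nth d (there x∈xs) with ∈⇒nth d x∈xs
... | j , j<len , e = suc j , s≤s j<len , e

module Layers {n : ℕ} (G : Graph n) (dec : DecidableAdjacency G) (conn : Connected G) (r : Fin n) where
  open Depth G dec conn r

  deep : ℕ → Fin n → Bool
  deep L v = L ≤ᵇ depth v

  inClass : ℕ → ℕ → ℕ → Fin n → Bool
  inClass q' L i v = deep L v ∧ (depth v % suc q' ≡ᵇ i)

  classSize : ℕ → ℕ → ℕ → ℕ
  classSize q' L i = count (inClass q' L i)

  nearClass : ∀ q' L i → i < suc q' → ∀ v → L + q' ≤ depth v →
              ∃₂ λ u k → T (inClass q' L i u) × k ≤ q' × Within G k u v
  nearClass q' L i i<q v deepEnough with residueBelow q' i (depth v) i<q i≤dv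
    where
    i≤dv : i ≤ depth v
    i≤dv = ≤-trans (≤-pred i<q) (≤-trans (m≤n+m q' L) deepEnough)
  ... | a , k , a+k≡dv , k≤q' , a%q≡i with ancestor k a v a+k≡dv
  ... | u , du≡a , p = u , k , member , k≤q' , p
    where
    L≤a : L ≤ a
    L≤a = ≮⇒≥ (λ a<L → <⇒≱ (+-mono-<-≤ a<L k≤q') (subst (L + q' ≤_) (sym a+k≡dv) deepEnough))
    member : T (inClass q' L i u)
    member rewrite du≡a = Equivalence.from T-∧ (≤⇒≤ᵇ L≤a , ≡⇒≡ᵇ _ _ a%q≡i)

  -- Burning the root first and then the class burns G within m + 1 rounds:
  -- shallow vertices are reached from the root, deep ones from their class ancestor.
  classBurns : ∀ q' L i → i < suc q' → ∀ m →
               classSize q' L i + q' ≤ m → L + q' ≤ suc m → BurnsIn G (suc m)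
  classBurns q' L i i<q m sizeOk levelOk = Burning.burnsByCover G dec centre m covered
    where
    members : List (Fin n)
    members = filterᵇ (inClass q' L i) (allFin n)
    centre : ℕ → Fin n
    centre j = nth (r ∷ members) j r
    covered : ∀ v → ∃₂ λ j k → j + k ≤ m × Within G k (centre j) v
    covered v with L + q' ≤? depth v
    ... | no shallow = 0 , depth v , ≤-pred (≤-trans (≰⇒> shallow) levelOk) , root-within v
    ... | yes deepEnough with nearClass q' L i i<q v deepEnough
    ... | u , k , uIn , k≤q' , p with ∈⇒nth r (∈-filter⁺ (λ w → T? (inClass q' L i w)) (∈-allFin u) uIn)
    ... | j , j<len , nth≡u = suc j , k , ≤-trans (+-mono-≤ j<size k≤q') sizeOk ,
                              subst (λ x → Within G k x v) (sym nth≡u) p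
      where
      j<size : suc j ≤ classSize q' L i
      j<size = subst (suc j ≤_) (length-filter-tabulate (λ w → w) (inClass q' L i)) j<len

  sparseClass : ∀ q' L → ∃ λ i → i < suc q' × suc q' * classSize q' L i ≤ count (deep L)
  sparseClass q' L with belowAverage q' (λ i → classSize q' L (toℕ i))
  ... | i , avg = toℕ i , toℕ<n i ,
    ≤-trans avg (≤-reflexive (count-partition (suc q') (deep L) (λ v → depth v % suc q') (λ v → m%n<n (depth v) (suc q'))))

  -- b(G) ≤ 2(c' + 1) whenever n ≤ (c' + 1)²: classes modulo c' + 1 above level 0.
  burnsInTwiceSqrt : ∀ c' → n ≤ suc c' * suc c' → ∃ λ B → BurnsIn G B × B ≤ suc c' + suc c'
  burnsInTwiceSqrt c' n≤c² with sparseClass c' 0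
  ... | i , i<q , avg = suc (size + c') ,
                        classBurns c' 0 i i<q (size + c') ≤-refl (m≤n⇒m≤1+n (m≤n+m c' size)) ,
                        subst (suc (size + c') ≤_) (sym (+-suc (suc c') c')) (s≤s (+-monoˡ-≤ c' size≤c))
    where
    size : ℕ
    size = classSize c' 0 i
    size≤c : size ≤ suc c'
    size≤c = *-cancelˡ-≤ (suc c') (≤-trans avg (≤-trans (count≤n (deep 0)) n≤c²))

  -- At least three vertices (the root and two neighbours) have depth below 2.
  fewDeep : ∀ {a b} → Adj G r a → Adj G r b → a ≢ b → count (deep 2) + 3 ≤ n
  fewDeep {a} {b} r~a r~b a≢b =
    subst (count (deep 2) + 3 ≤_) (count-complement (deep 2))
      (+-monoʳ-≤ (count (deep 2))
        (distinct≤count (λ v → not (deep 2 v)) {r ∷ a ∷ b ∷ []}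
          ((r≢ r~a ∷ r≢ r~b ∷ []) ∷ (a≢b ∷ []) ∷ [] ∷ [])
          (shallow (subst (λ k → k ≤ 1) (sym root-depth) z≤n) ∷ shallow (depth-neighbour r~a)
            ∷ shallow (depth-neighbour r~b) ∷ [])))
    where
    root-depth : depth r ≡ 0
    root-depth = ≤-antisym (depth-least {0} refl) z≤n
    r≢ : ∀ {v} → Adj G r v → r ≢ v
    r≢ r~v refl = irrefl G r~v
    shallow : ∀ {v} → depth v ≤ 1 → T (not (deep 2 v))
    shallow {v} d≤1 with depth v | d≤1
    ... | zero     | _ = _
    ... | suc zero | _ = _
    ... | suc (suc _) | s≤s ()

  -- 3·b(G) ≤ n + 6 when the root has two distinct neighbours: classes modulo 3 above level 2.
  burnsInThird : ∀ {a b} → Adj G r a → Adj G r b → a ≢ b → 6 ≤ n →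
                 ∃ λ B → BurnsIn G B × 3 * B ≤ n + 6
  burnsInThird r~a r~b a≢b 6≤n with sparseClass 2 2
  ... | i , i<3 , avg = bySize (classSize 2 2 i) ≤-refl avg
    where
    bySize : ∀ s → classSize 2 2 i ≤ s → 3 * s ≤ count (deep 2) → ∃ λ B → BurnsIn G B × 3 * B ≤ n + 6
    bySize zero     size≤s _ =
      4 , classBurns 2 2 i i<3 3 (≤-trans (+-monoˡ-≤ 2 size≤s) (n≤1+n 2)) ≤-refl , +-monoˡ-≤ 6 6≤n
    bySize (suc s') size≤s 3s≤deep =
      suc (suc s' + 2) , classBurns 2 2 i i<3 (suc s' + 2) (+-monoˡ-≤ 2 size≤s) (s≤s (s≤s (m≤n+m 2 s'))) ,
      rounds
      where
      open ≤-Reasoning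
      rounds : 3 * suc (suc s' + 2) ≤ n + 6
      rounds = begin
        3 * suc (suc s' + 2)    ≡⟨ cong (3 *_) (+-suc (suc s') 2) ⟨
        3 * (suc s' + 3)        ≡⟨ *-distribˡ-+ 3 (suc s') 3 ⟩
        3 * suc s' + 9          ≤⟨ +-monoˡ-≤ 9 3s≤deep ⟩
        count (deep 2) + 9      ≡⟨ +-assoc (count (deep 2)) 3 6 ⟨
        count (deep 2) + 3 + 6  ≤⟨ +-monoˡ-≤ 6 (fewDeep r~a r~b a≢b) ⟩
        n + 6 ∎

burningNumberBounds : ∀ {n} (G : Graph n) → DecidableAdjacency G → Connected G → 6 ≤ n →
                      ∀ c → n ≤ c * c → ∀ b → (∀ k → BurnsIn G k → b ≤ k) →
                      3 * b ≤ n + 6 × b ≤ c + c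
burningNumberBounds G dec conn 6≤n zero n≤0 b least = ⊥-elim (<⇒≱ (s≤s z≤n) (≤-trans 6≤n n≤0))
burningNumberBounds G dec conn 6≤n@(s≤s (s≤s (s≤s _))) (suc c') n≤c² b least =
  let (r , a , a' , r~a , r~a' , a≢a') = twoNeighbours G dec conn
      (B₁ , burns₁ , third) = Layers.burnsInThird G dec conn r r~a r~a' a≢a' 6≤n
      (B₂ , burns₂ , twice) = Layers.burnsInTwiceSqrt G dec conn r c' n≤c²
  in ≤-trans (*-monoʳ-≤ 3 (least B₁ burns₁)) third , ≤-trans (least B₂ burns₂) twice

Near : ∀ {n} → Graph n → Fin n → Fin n → Set
Near G r w = r ≡ w ⊎ Adj G r w ⊎ ∃ λ x → Adj G r x × Adj G x w

near? : ∀ {n} (G : Graph n) → DecidableAdjacency G → ∀ r w → Dec (Near G r w)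
near? G dec r w = (r ≟ᶠ w) ⊎-dec dec r w ⊎-dec anyᶠ? (λ x → dec r x ×-dec dec x w)

near⇒within : ∀ {n} (G : Graph n) {r w} → Near G r w → Within G 2 r w
near⇒within G (inj₁ refl)                    = stay
near⇒within G (inj₂ (inj₁ r~w))              = step stay r~w
near⇒within G (inj₂ (inj₂ (x , r~x , x~w))) = step (step stay r~x) x~w

far⇒adjacentᶜ : ∀ {n} (G : Graph n) {r w} → ¬ Near G r w → Adj (complement G) r w
far⇒adjacentᶜ G far = (λ e → far (inj₁ e)) , (λ a → far (inj₂ (inj₁ a)))

-- If w is not near r in G, then r reaches every vertex within two steps in the
-- complement, directly or through w.
farComplement : ∀ {n} (G : Graph n) → DecidableAdjacency G → ∀ {r w} → ¬ Near G r w →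
                ∀ x → Within (complement G) 2 r x
farComplement G dec {r} {w} far x with r ≟ᶠ x
... | yes refl = stay
... | no r≢x with w ≟ᶠ x
...   | yes refl = step stay (far⇒adjacentᶜ G far)
...   | no w≢x with dec r x
...     | no ¬r~x = step stay (r≢x , ¬r~x)
...     | yes r~x = step (step stay (far⇒adjacentᶜ G far)) (w≢x , λ w~x → far (inj₂ (inj₂ (x , r~x , Graph.sym G w~x))))

oneSideBurnsInThree : ∀ {n} (G : Graph n) → DecidableAdjacency G → Fin n →
                      BurnsIn G 3 ⊎ BurnsIn (complement G) 3
oneSideBurnsInThree G dec r with anyᶠ? (λ w → ¬? (near? G dec r w))
... | yes (w , far) = inj₂ (radiusTwoBurns (complement G) (complement-dec G dec) r (farComplement G dec far))
... | no allNear    = inj₁ (radiusTwoBurns G dec r (λ w → near⇒within G (nearAll w)))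
  where
  nearAll : ∀ w → Near G r w
  nearAll w = decidable-stable (near? G dec r w) (λ far → allNear (w , far))

combineBounds : ∀ {n x y} c → 6 ≤ n → n ≤ c * c → 3 * x ≤ n + 6 → x ≤ c + c → y ≤ 3 →
                (x + y ≤ 3 * c ∸ 1) × (x * y ≤ n + 6)
combineBounds {n} {x} {y} c 6≤n n≤c² third twice y≤3 = sumBound c n≤c² twice , productBound
  where
  productBound : x * y ≤ n + 6
  productBound = ≤-trans (*-monoʳ-≤ x y≤3) (subst (_≤ n + 6) (*-comm 3 x) third)
  sumBound : ∀ c → n ≤ c * c → x ≤ c + c → x + y ≤ 3 * c ∸ 1
  sumBound 0 n≤ _ = ⊥-elim (<⇒≱ (s≤s z≤n) (≤-trans 6≤n n≤))
  sumBound 1 n≤ _ = ⊥-elim (<⇒≱ (s≤s (s≤s z≤n)) (≤-trans 6≤n n≤))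
  sumBound 2 n≤ _ = ⊥-elim (<⇒≱ (s≤s (s≤s (s≤s (s≤s (s≤s z≤n))))) (≤-trans 6≤n n≤))
  sumBound 3 n≤ _ = +-mono-≤ x≤5 y≤3
    where
    x≤5 : x ≤ 5
    x≤5 = *-cancelˡ-≤ 3 (≤-trans third (+-monoˡ-≤ 6 n≤))
  sumBound c@(suc c₁@(suc (suc (suc _)))) _ x≤2c = begin
    x + y           ≤⟨ +-mono-≤ x≤2c y≤3 ⟩
    c + c + 3       ≤⟨ +-monoʳ-≤ (c + c) (s≤s (s≤s (s≤s z≤n))) ⟩
    c + c + c₁      ≡⟨ +-∸-assoc (c + c) (s≤s z≤n) ⟨
    c + c + c ∸ 1   ≡⟨ cong (_∸ 1) (+-assoc c c c) ⟩
    c + (c + c) ∸ 1 ≡⟨ cong (λ z → c + (c + z) ∸ 1) (+-identityʳ c) ⟨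
    3 * c ∸ 1 ∎
    where open ≤-Reasoning

-- The corollary under decidable adjacency: apply the layer bounds to the side whose
-- partner burns within three rounds, starting the dichotomy from any vertex.
boundsDecidable : ∀ {n} (G : Graph n) → DecidableAdjacency G → 6 ≤ n →
                  Connected G → Connected (complement G) →
                  ∀ b₁ b₂ c → IsBurningNumber G b₁ → IsBurningNumber (complement G) b₂ →
                  n ≤ c * c → (b₁ + b₂ ≤ 3 * c ∸ 1) × (b₁ * b₂ ≤ n + 6)
boundsDecidable {n} G dec 6≤n@(s≤s _) conn connᶜ b₁ b₂ c (_ , least₁) (_ , least₂) n≤c²
  with oneSideBurnsInThree G dec fz
... | inj₂ burnsᶜ =
  let (third , twice) = burningNumberBounds G dec conn 6≤n c n≤c² b₁ least₁
  in combineBounds c 6≤n n≤c² third twice (least₂ 3 burnsᶜ)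
... | inj₁ burns  =
  let (third , twice) = burningNumberBounds (complement G) (complement-dec G dec) connᶜ 6≤n c n≤c² b₂ least₂
      (sumOk , productOk) = combineBounds c 6≤n n≤c² third twice (least₁ 3 burns)
  in subst (_≤ 3 * c ∸ 1) (+-comm b₂ b₁) sumOk , subst (_≤ n + 6) (*-comm b₂ b₁) productOk

corollary22 : ∀ (n : ℕ) (G : Graph n) → 6 ≤ n →
    Connected G → Connected (complement G) →
    ∀ (b₁ b₂ c : ℕ) → IsBurningNumber G b₁ → IsBurningNumber (complement G) b₂ →
    IsCeilSqrt n c →
    (b₁ + b₂ ≤ 3 * c ∸ 1) × (b₁ * b₂ ≤ n + 6)
corollary22 n G 6≤n conn connᶜ b₁ b₂ c isB₁ isB₂ (n≤c² , _) =
  decidable-stable ((_ ≤? _) ×-dec (_ ≤? _)) λ ¬goal →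
    ¬¬-decidableAdjacency G (λ dec → ¬goal (boundsDecidable G dec 6≤n conn connᶜ b₁ b₂ c isB₁ isB₂ n≤c²))
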